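{- For any logic program $\Phi$, the program $F(\Phi)$ is productive and non-overlapping.
   Context: Atomic formulas $P(t_1,\dots,t_n)$ over first-order terms; a logic program is a list of closed Horn formulas $\kappa:\forall\underline{x}.B_1,\dots,B_m\Rightarrow C$ ($m\ge0$) labelled by distinct constants $\kappa$. For $A\equiv P(t_1,\dots,t_n)$ and a term $t'$ with free variables disjoint from those of the $t_i$, $A[t']$ denotes $P(t_1,\dots,t_n,t')$. The realizability transformation $F(\Phi)$ replaces each axiom $\kappa:\forall\underline{x}.A_1,\dots,A_m\Rightarrow B$ of $\Phi$ by $\kappa:\forall\underline{x}.\forall\underline{y}.A_1[y_1],\dots,A_m[y_m]\Rightarrow B[f_\kappa(y_1,\dots,y_m)]$, where $y_1,\dots,y_m$ are fresh distinct variables and $f_\kappa$ is a new function symbol of arity $m$ uniquely associated with $\kappa$. Term-matching reduction on multisets of atomic formulas: $\Psi\vdash\{A_1,\dots,A_i,\dots,A_n\}\to\{A_1,\dots,\sigma B_1,\dots,\sigma B_m,\dots,A_n\}$ if $\kappa:\forall\underline{x}.B_1,\dots,B_m\Rightarrow C\in\Psi$ (variables renamed apart) and $\sigma C\equiv A_i$. A program is productive if every $\to$-reduction (from any multiset of atomic formulas) is finite. A program is non-overlapping if for any two formulas $\forall\underline{x}.\underline{B}\Rightarrow C$ and $\forall\underline{x}.\underline{D}\Rightarrow E$ in it there are no substitutions $\sigma,\delta$ with $\sigma C\equiv\delta E$. -}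

module Defs where

open import Data.Nat using (ℕ; zero; suc; _+_; _⊔_)
open import Data.List using (List; []; _∷_; _++_; map; length; upTo; lookup)
import Data.List
open import Data.Product using (_×_; _,_; proj₁; proj₂; Σ)
open import Data.Sum using (_⊎_; inj₁; inj₂)
open import Data.Fin using (Fin)
open import Data.List.Membership.Propositional using (_∈_)
open import Relation.Binary.PropositionalEquality using (_≡_; _≢_)
open import Relation.Nullary using (¬_)

-- First-order terms over function symbols Fn, variables ℕ.
-- (Arities are not enforced: terms are "untyped" applications.)

data Term (Fn : Set) : Set where
  var : ℕ → Term Fn
  fn  : Fn → List (Term Fn) → Term Fn

record Atom (Pr Fn : Set) : Set where
  constructor atom
  field
    pred : Pr
    args : List (Term Fn)
open Atom public

-- A Horn formula ∀x. B₁,…,Bₘ ⇒ C (all variables implicitly universally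
-- quantified, i.e. the formula is closed).
record Clause (Pr Fn : Set) : Set where
  constructor _⇐_
  field
    head : Atom Pr Fn
    body : List (Atom Pr Fn)
open Clause public

Program : (Pr Fn L : Set) → Set
Program Pr Fn L = List (L × Clause Pr Fn)

-- Distinctness of labels is stated separately (Unique on the labels).

Subst : Set → Set
Subst Fn = ℕ → Term Fn

mutual
  substT : ∀ {Fn} → Subst Fn → Term Fn → Term Fn
  substT σ (var x)   = σ x
  substT σ (fn f ts) = fn f (substTs σ ts)

  substTs : ∀ {Fn} → Subst Fn → List (Term Fn) → List (Term Fn)
  substTs σ []       = []
  substTs σ (t ∷ ts) = substT σ t ∷ substTs σ ts

substA : ∀ {Pr Fn} → Subst Fn → Atom Pr Fn → Atom Pr Fn
substA σ (atom P ts) = atom P (substTs σ ts)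

_[_] : ∀ {Pr Fn} → Atom Pr Fn → Term Fn → Atom Pr Fn
atom P ts [ t ] = atom P (ts ++ Data.List.[_] t)

mutual
  varBoundT : ∀ {Fn} → Term Fn → ℕ
  varBoundT (var x)   = suc x
  varBoundT (fn f ts) = varBoundTs ts

  varBoundTs : ∀ {Fn} → List (Term Fn) → ℕ
  varBoundTs []       = 0
  varBoundTs (t ∷ ts) = varBoundT t ⊔ varBoundTs ts

varBoundA : ∀ {Pr Fn} → Atom Pr Fn → ℕ
varBoundA (atom P ts) = varBoundTs ts

varBoundAs : ∀ {Pr Fn} → List (Atom Pr Fn) → ℕ
varBoundAs []       = 0
varBoundAs (A ∷ As) = varBoundA A ⊔ varBoundAs As

varBoundC : ∀ {Pr Fn} → Clause Pr Fn → ℕ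
varBoundC (C ⇐ Bs) = varBoundA C ⊔ varBoundAs Bs

-- Embedding the old signature into the extended one Fn ⊎ L
-- (inj₂ κ is the new function symbol f_κ).

mutual
  liftT : ∀ {Fn L} → Term Fn → Term (Fn ⊎ L)
  liftT (var x)   = var x
  liftT (fn f ts) = fn (inj₁ f) (liftTs ts)

  liftTs : ∀ {Fn L} → List (Term Fn) → List (Term (Fn ⊎ L))
  liftTs []       = []
  liftTs (t ∷ ts) = liftT t ∷ liftTs ts

liftA : ∀ {Pr Fn L} → Atom Pr Fn → Atom Pr (Fn ⊎ L)
liftA (atom P ts) = atom P (liftTs ts)

-- For κ : ∀x. A₁,…,Aₘ ⇒ B, with fresh distinct variables
-- y_k = var (N + k), N = varBoundC (the clause), k = 0,…,m-1:
--   κ : ∀x y. A₁[y₁],…,Aₘ[yₘ] ⇒ B[f_κ(y₁,…,yₘ)]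

extendBody : ∀ {Pr Fn} → ℕ → ℕ → List (Atom Pr Fn) → List (Atom Pr Fn)
extendBody N k []       = []
extendBody N k (A ∷ As) = (A [ var (N + k) ]) ∷ extendBody N (suc k) As

realizeClause : ∀ {Pr Fn L} → L → Clause Pr Fn → Clause Pr (Fn ⊎ L)
realizeClause {L = L} κ (B ⇐ As) =
  (liftA B [ fn (inj₂ κ) (map (λ k → var (N + k)) (upTo (length As))) ])
    ⇐ extendBody N 0 (map liftA As)
  where
    N : ℕ
    N = varBoundC (B ⇐ As)

F : ∀ {Pr Fn L} → Program Pr Fn L → Program Pr (Fn ⊎ L) L
F []             = []
F ((κ , c) ∷ Φ)  = (κ , realizeClause κ c) ∷ F Φ

-- Term-matching reduction on multisets (represented as lists; the
-- reduction acts at an arbitrary position, so order is immaterial).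

data _⊢_⟶_ {Pr Fn L : Set} (Ψ : Program Pr Fn L)
     : List (Atom Pr Fn) → List (Atom Pr Fn) → Set where
  step : ∀ (xs ys : List (Atom Pr Fn)) {κ : L} {c : Clause Pr Fn}
           (σ : Subst Fn) →
         (κ , c) ∈ Ψ →
         Ψ ⊢ (xs ++ substA σ (head c) ∷ ys)
           ⟶ (xs ++ map (substA σ) (body c) ++ ys)

Productive : ∀ {Pr Fn L} → Program Pr Fn L → Set
Productive {Pr} {Fn} Ψ =
  ¬ (Σ (ℕ → List (Atom Pr Fn)) λ s → ∀ n → Ψ ⊢ s n ⟶ s (suc n))

NonOverlapping : ∀ {Pr Fn L} → Program Pr Fn L → Set
NonOverlapping {Fn = Fn} Ψ =
  ∀ (i j : Fin (length Ψ)) → i ≢ j → ∀ (σ δ : Subst Fn) →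
    substA σ (head (proj₂ (lookup Ψ i))) ≢ substA δ (head (proj₂ (lookup Ψ j)))

-- In F(Φ) the last argument of every atom plays the role of a realizer.
-- Matching the head of κ against an atom forces its realizer to be
-- f_κ(σ y₁, …, σ yₘ), and the step replaces it by atoms whose realizers are
-- the σ yᵢ.  Hence the total size of realizers strictly decreases along
-- every reduction, and reductions are finite.  The head realizers of two
-- clauses start with the distinct symbols f_κ and f_κ', so no two heads have
-- a common instance.
module Submission where

open import Defs
open import Data.List.Relation.Unary.Unique.Propositional using (Unique)

open import Data.Nat using (ℕ; suc; _+_; _<_)
open import Data.Nat.Properties
  using (+-identityʳ; +-suc; n<1+n; +-monoʳ-<; +-monoˡ-<; module ≤-Reasoning)
open import Data.Nat.Induction using (<-wellFounded)
open import Data.List using (List; map; []; _∷_; _++_; _∷ʳ_; length; applyUpTo; upTo; lookup; last)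
open import Data.Nat.ListAction using (sum)
open import Data.Nat.ListAction.Properties using (sum-++)
open import Data.List.Properties using (map-++; length-map; map-upTo)
open import Data.List.Membership.Propositional.Properties using (∈-lookup)
open import Data.List.Relation.Unary.All as All using (All; []; _∷_)
open import Data.List.Relation.Unary.All.Properties using (map⁻)
open import Data.List.Relation.Unary.AllPairs using (_∷_)
open import Data.Maybe using (Maybe; just; maybe)
open import Data.Product using (_×_; _,_; proj₁; proj₂; Σ)
open import Data.Sum using (_⊎_; inj₂)
open import Data.Fin using (Fin; zero; suc)
open import Data.Empty using (⊥-elim)
open import Function using (_∘_; id)
open import Induction.WellFounded using (Acc; acc)
open import Relation.Nullary using (¬_)
open import Relation.Binary.PropositionalEquality
  using (_≡_; _≢_; refl; sym; trans; cong; cong₂; subst; subst₂; ≢-sym; module ≡-Reasoning)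

no-descending-sequence : (f : ℕ → ℕ) → ¬ (∀ n → f (suc n) < f n)
no-descending-sequence f = descend f (<-wellFounded (f 0))
  where
    descend : (f : ℕ → ℕ) → Acc _<_ (f 0) → ¬ (∀ n → f (suc n) < f n)
    descend f (acc rs) f↓ = descend (f ∘ suc) (rs (f↓ 0)) (f↓ ∘ suc)

last-∷ʳ : ∀ {A : Set} (xs : List A) (x : A) → last (xs ∷ʳ x) ≡ just x
last-∷ʳ []           x = refl
last-∷ʳ (_ ∷ [])     x = refl
last-∷ʳ (_ ∷ y ∷ xs) x = last-∷ʳ (y ∷ xs) x

unique-map-lookup : ∀ {A B : Set} (f : A → B) {xs : List A} → Unique (map f xs) →
                    {i j : Fin (length xs)} → i ≢ j → f (lookup xs i) ≢ f (lookup xs j)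
unique-map-lookup f {_ ∷ _}  _       {zero}  {zero}  i≢j = ⊥-elim (i≢j refl)
unique-map-lookup f {_ ∷ _}  (x≢ ∷ _) {zero}  {suc j} _   = All.lookup (map⁻ x≢) (∈-lookup j)
unique-map-lookup f {_ ∷ _}  (x≢ ∷ _) {suc i} {zero}  _   = ≢-sym (All.lookup (map⁻ x≢) (∈-lookup i))
unique-map-lookup f {_ ∷ xs} (_ ∷ u)  {suc i} {suc j} i≢j =
  unique-map-lookup f u (i≢j ∘ cong suc)

module _ {Fn : Set} where

  mutual
    size : Term Fn → ℕ
    size (var _)   = 1
    size (fn _ ts) = suc (sizes ts)

    sizes : List (Term Fn) → ℕ
    sizes []       = 0
    sizes (t ∷ ts) = size t + sizes ts

  freshVars : ℕ → (ℕ → ℕ) → ℕ → List (Term Fn)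
  freshVars N f = applyUpTo (λ i → var (N + f i))

  substTs-++ : ∀ (σ : Subst Fn) xs ys → substTs σ (xs ++ ys) ≡ substTs σ xs ++ substTs σ ys
  substTs-++ σ []       ys = refl
  substTs-++ σ (x ∷ xs) ys = cong (substT σ x ∷_) (substTs-++ σ xs ys)

module _ {Pr Fn : Set} (w : Atom Pr Fn → ℕ) where

  weight : List (Atom Pr Fn) → ℕ
  weight = sum ∘ map w

  weight-++ : ∀ xs ys → weight (xs ++ ys) ≡ weight xs + weight ys
  weight-++ xs ys = trans (cong sum (map-++ w xs ys)) (sum-++ (map w xs) (map w ys))

  Decreasing : Clause Pr Fn → Set
  Decreasing c = ∀ σ → weight (map (substA σ) (body c)) < w (substA σ (head c))

  step-decreasing : ∀ {L} {Ψ : Program Pr Fn L} → All (Decreasing ∘ proj₂) Ψ →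
                    ∀ {as bs} → Ψ ⊢ as ⟶ bs → weight bs < weight as
  step-decreasing Ψ↓ (step xs ys {c = c} σ κ∈Ψ) = begin-strict
    weight (xs ++ Bs ++ ys)       ≡⟨ weight-++ xs (Bs ++ ys) ⟩
    weight xs + weight (Bs ++ ys) ≡⟨ cong (weight xs +_) (weight-++ Bs ys) ⟩
    weight xs + (weight Bs + weight ys)
      <⟨ +-monoʳ-< (weight xs) (+-monoˡ-< (weight ys) (All.lookup Ψ↓ κ∈Ψ σ)) ⟩
    weight xs + weight (C ∷ ys)   ≡⟨ weight-++ xs (C ∷ ys) ⟨
    weight (xs ++ C ∷ ys)         ∎
    where
      open ≤-Reasoning
      Bs = map (substA σ) (body c)
      C  = substA σ (head c)

  decreasing⇒productive : ∀ {L} {Ψ : Program Pr Fn L} → All (Decreasing ∘ proj₂) Ψ → Productive Ψ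
  decreasing⇒productive Ψ↓ (s , s⟶) =
    no-descending-sequence (weight ∘ s) (step-decreasing Ψ↓ ∘ s⟶)

module _ {Pr Fn : Set} where

  realizer : Atom Pr Fn → Maybe (Term Fn)
  realizer = last ∘ args

  realizerSize : Atom Pr Fn → ℕ
  realizerSize = maybe size 0 ∘ realizer

  realizer-substA-[] : ∀ σ (A : Atom Pr Fn) t →
                       realizer (substA σ (A [ t ])) ≡ just (substT σ t)
  realizer-substA-[] σ A t =
    trans (cong last (substTs-++ σ (args A) (t ∷ []))) (last-∷ʳ (substTs σ (args A)) (substT σ t))

  -- f is kept abstract because the k in extendBody N k only agrees with
  -- the indices of applyUpTo up to propositional equality.
  realizerSizes-extendBody : ∀ σ N k (As : List (Atom Pr Fn)) f → (∀ i → f i ≡ k + i) →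
    weight realizerSize (map (substA σ) (extendBody N k As)) ≡ sizes (substTs σ (freshVars N f (length As)))
  realizerSizes-extendBody σ N k []       f f≗k+ = refl
  realizerSizes-extendBody σ N k (A ∷ As) f f≗k+ = cong₂ _+_
    (begin
      realizerSize (substA σ (A [ var (N + k) ])) ≡⟨ cong (maybe size 0) (realizer-substA-[] σ A (var (N + k))) ⟩
      size (σ (N + k))                            ≡⟨ cong (λ i → size (σ (N + i))) (sym (trans (f≗k+ 0) (+-identityʳ k))) ⟩
      size (σ (N + f 0))                          ∎)
    (realizerSizes-extendBody σ N (suc k) As (f ∘ suc) (λ i → trans (f≗k+ (suc i)) (+-suc k i)))
    where open ≡-Reasoning

module _ {Pr Fn L : Set} where

  realizerVars : Clause Pr Fn → List (Term (Fn ⊎ L))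
  realizerVars c = map (λ i → var (varBoundC c + i)) (upTo (length (body c)))

  realizeClause-decreasing : ∀ κ (c : Clause Pr Fn) → Decreasing realizerSize (realizeClause κ c)
  realizeClause-decreasing κ c@(B ⇐ As) σ = begin-strict
    weight realizerSize (map (substA σ) (extendBody N 0 (map liftA As)))
      ≡⟨ realizerSizes-extendBody σ N 0 (map liftA As) id (λ _ → refl) ⟩
    sizes (substTs σ (freshVars N id (length (map liftA As))))
      ≡⟨ cong (sizes ∘ substTs σ ∘ freshVars N id) (length-map liftA As) ⟩
    sizes (substTs σ (freshVars N id (length As)))
      ≡⟨ cong (sizes ∘ substTs σ) (map-upTo (λ i → var (N + i)) (length As)) ⟨
    sizes (substTs σ ys)
      <⟨ n<1+n _ ⟩
    size (substT σ (fn (inj₂ κ) ys))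
      ≡⟨ cong (maybe size 0) (realizer-substA-[] σ (liftA B) (fn (inj₂ κ) ys)) ⟨
    realizerSize (substA σ (liftA B [ fn (inj₂ κ) ys ])) ∎
    where
      open ≤-Reasoning
      N = varBoundC c
      ys = realizerVars c

  head-realizer : ∀ σ κ (c : Clause Pr Fn) →
    realizer (substA σ (head (realizeClause κ c))) ≡ just (substT σ (fn (inj₂ κ) (realizerVars c)))
  head-realizer σ κ c = realizer-substA-[] σ (liftA (head c)) (fn (inj₂ κ) (realizerVars c))

  common-instance⇒same-label : ∀ σ δ κ κ' (c c' : Clause Pr Fn) →
    substA σ (head (realizeClause κ c)) ≡ substA δ (head (realizeClause κ' c')) → κ ≡ κ'
  common-instance⇒same-label σ δ κ κ' c c' eq = symbol-injective (begin
    just (substT σ (fn (inj₂ κ) (realizerVars c)))    ≡⟨ head-realizer σ κ c ⟨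
    realizer (substA σ (head (realizeClause κ c)))    ≡⟨ cong realizer eq ⟩
    realizer (substA δ (head (realizeClause κ' c')))  ≡⟨ head-realizer δ κ' c' ⟩
    just (substT δ (fn (inj₂ κ') (realizerVars c'))) ∎)
    where
      open ≡-Reasoning
      symbol-injective : ∀ {ts ts'} → just (fn (inj₂ κ) ts) ≡ just (fn (inj₂ κ') ts') → κ ≡ κ'
      symbol-injective refl = refl

  IsRealization : L × Clause Pr (Fn ⊎ L) → Set
  IsRealization (κ , c) = Σ (Clause Pr Fn) λ c₀ → c ≡ realizeClause κ c₀

  F-realizations : (Φ : Program Pr Fn L) → All IsRealization (F Φ)
  F-realizations []            = []
  F-realizations ((κ , c) ∷ Φ) = (c , refl) ∷ F-realizations Φ

  F-labels : (Φ : Program Pr Fn L) → map proj₁ (F Φ) ≡ map proj₁ Φ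
  F-labels []            = refl
  F-labels ((κ , _) ∷ Φ) = cong (κ ∷_) (F-labels Φ)

  F-productive : (Φ : Program Pr Fn L) → Productive (F Φ)
  F-productive Φ = decreasing⇒productive realizerSize
    (All.map (λ { {κ , _} (c₀ , refl) → realizeClause-decreasing κ c₀ }) (F-realizations Φ))

  F-nonOverlapping : (Φ : Program Pr Fn L) → Unique (map proj₁ Φ) → NonOverlapping (F Φ)
  F-nonOverlapping Φ unique i j i≢j σ δ eq
    with All.lookup (F-realizations Φ) (∈-lookup i) | All.lookup (F-realizations Φ) (∈-lookup j)
  ... | c , cᵢ≡ | c' , cⱼ≡ =
    unique-map-lookup proj₁ (subst Unique (sym (F-labels Φ)) unique) i≢j
      (common-instance⇒same-label σ δ _ _ c c'
        (subst₂ (λ cᵢ cⱼ → substA σ (head cᵢ) ≡ substA δ (head cⱼ)) cᵢ≡ cⱼ≡ eq))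

proposition1 : ∀ {Pr Fn L : Set} (Φ : Program Pr Fn L) →
    Unique (map proj₁ Φ) →
    Productive (F Φ) × NonOverlapping (F Φ)
proposition1 Φ unique = F-productive Φ , F-nonOverlapping Φ unique
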